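{- Let $Y$ be a connected finite simple undirected graph and $e=\{v,w\}$ a cycle-edge of $Y$. Let $O^1,O^2\in\mathsf{Acyc}(Y)$ be $\kappa$-equivalent with $v\leq_{O^1}w$ and $v\leq_{O^2}w$. Then $\mathcal{I}(O^1)=\mathcal{I}(O^2)$. Consequently the map $\mathcal{I}^*$ on $\kappa$-classes given by $\mathcal{I}^*([O])=\mathcal{I}(O^1)$, for any $O^1\in[O]$ with $\mathcal{I}(O^1)\neq\varnothing$, is well defined.
   Context: A cycle-edge is an edge that is not a bridge, i.e. lies on a cycle. $\mathsf{Acyc}(Y)$ is the set of acyclic orientations of $Y$. Each $O\in\mathsf{Acyc}(Y)$ gives a partial order on the vertices: $i\le_O j$ if there is a directed path from $i$ to $j$ in $O$. $\mathcal{I}(O)$ (the $vw$-interval) is, when $v\le_O w$, the interval $[v,w]=\{c: v\le_O c\le_O w\}$, viewed as the subgraph of $O$ induced on the vertices lying on directed paths from $v$ to $w$ (with relations inherited from $O$); if not $v\le_O w$, $\mathcal{I}(O)=\varnothing$. A click on $O$ converts a source of $O$ into a sink by reversing its incident edges; $O\sim_\kappa O'$ ($\kappa$-equivalent) if one is obtained from the other by a finite sequence of clicks, and $[O]$ denotes the $\kappa$-class of $O$. Every $\kappa$-class contains some $O$ with $v\le_O w$. -}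

module Defs where

open import Data.Nat using (ℕ)
open import Data.Fin using (Fin; _≟_)
open import Data.Bool using (Bool; true; false; if_then_else_; _∨_)
open import Data.Product using (Σ; _×_; _,_)
open import Data.Empty using (⊥)
open import Data.Sum using (_⊎_)
open import Relation.Nullary using (¬_)
open import Relation.Nullary.Decidable using (⌊_⌋)
open import Relation.Binary.PropositionalEquality using (_≡_; _≢_)
open import Relation.Binary.Construct.Closure.ReflexiveTransitive using (Star)
open import Relation.Binary.Construct.Closure.Transitive using (TransClosure)
open import Function.Bundles using (_⇔_)

record Graph (n : ℕ) : Set where
  field
    adj   : Fin n → Fin n → Bool
    sym   : ∀ i j → adj i j ≡ adj j i
    irrefl : ∀ i → adj i i ≡ false
open Graph public

Edge : ∀ {n} → Graph n → Fin n → Fin n → Set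
Edge Y i j = adj Y i j ≡ true

Connected : ∀ {n} → Graph n → Set
Connected Y = ∀ i j → Star (Edge Y) i j

EdgeMinus : ∀ {n} → Graph n → Fin n → Fin n → Fin n → Fin n → Set
EdgeMinus Y v w i j =
  Edge Y i j × ¬ ((i ≡ v × j ≡ w) ⊎ (i ≡ w × j ≡ v))

-- {v,w} is a cycle-edge (not a bridge): it is an edge and its endpoints
-- remain connected after deleting it (i.e. deleting it does not disconnect).
CycleEdge : ∀ {n} → Graph n → Fin n → Fin n → Set
CycleEdge Y v w = Edge Y v w × Star (EdgeMinus Y v w) v w

-- An orientation O of Y: O i j ≡ true means the edge {i,j} is directed i → j.
-- Each edge gets exactly one direction; non-edges get none.
record IsOrientation {n} (Y : Graph n) (O : Fin n → Fin n → Bool) : Set where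
  field
    onEdges  : ∀ i j → O i j ≡ true → adj Y i j ≡ true
    oneWay   : ∀ i j → O i j ≡ true → O j i ≡ false
    someWay  : ∀ i j → adj Y i j ≡ true → (O i j ≡ true) ⊎ (O j i ≡ true)

Arc : ∀ {n} → (Fin n → Fin n → Bool) → Fin n → Fin n → Set
Arc O i j = O i j ≡ true

_≤[_]_ : ∀ {n} → Fin n → (Fin n → Fin n → Bool) → Fin n → Set
i ≤[ O ] j = Star (Arc O) i j

Acyclic : ∀ {n} → (Fin n → Fin n → Bool) → Set
Acyclic O = ∀ i → ¬ TransClosure (Arc O) i i

IsAcyc : ∀ {n} → Graph n → (Fin n → Fin n → Bool) → Set
IsAcyc Y O = IsOrientation Y O × Acyclic O

Source : ∀ {n} → (Fin n → Fin n → Bool) → Fin n → Set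
Source O s = ∀ j → O j s ≡ false

flipAt : ∀ {n} → Fin n → (Fin n → Fin n → Bool) → (Fin n → Fin n → Bool)
flipAt s O i j = if ⌊ i ≟ s ⌋ ∨ ⌊ j ≟ s ⌋ then O j i else O i j

Click : ∀ {n} → (Fin n → Fin n → Bool) → (Fin n → Fin n → Bool) → Set
Click {n} O O' = Σ (Fin n) λ s → Source O s × (∀ i j → O' i j ≡ flipAt s O i j)

_∼κ_ : ∀ {n} → (Fin n → Fin n → Bool) → (Fin n → Fin n → Bool) → Set
O ∼κ O' = Star Click O O' ⊎ Star Click O' O

InInterval : ∀ {n} → (Fin n → Fin n → Bool) → Fin n → Fin n → Fin n → Set
InInterval O v w c = (v ≤[ O ] c) × (c ≤[ O ] w)

-- Equality of the vw-intervals of O¹ and O² as subgraphs of the orientations: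
-- same vertex set, and the same directed edges among those vertices.
-- (The order relation among interval vertices, being the relation inherited
-- from the orientation, is then also the same; we include it explicitly.)
SameInterval : ∀ {n} → (Fin n → Fin n → Bool) → (Fin n → Fin n → Bool) →
               Fin n → Fin n → Set
SameInterval O¹ O² v w =
  (∀ c → InInterval O¹ v w c ⇔ InInterval O² v w c) ×
  (∀ a b → InInterval O¹ v w a → InInterval O¹ v w b → O¹ a b ≡ O² a b) ×
  (∀ a b → InInterval O¹ v w a → InInterval O¹ v w b →
     (a ≤[ O¹ ] b) ⇔ (a ≤[ O² ] b))

-- Let h s be the number of times s is clicked on the way from O¹ to O². A click reverses
-- exactly the arcs at a source, so every arc i → j of O¹ either survives with h i = h j or is
-- reversed with h i = h j + 1: arcs of O¹ run weakly down h, arcs of O² weakly up h, and the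
-- two orientations agree between vertices of equal height. The edge {v, w} is an arc v → w in
-- both (a reversed arc would close a directed cycle), so h v = h w, which traps each vw-interval
-- in the level set of h v, where O¹ and O² coincide.
module Submission where

open import Defs hiding (sym)
open import Data.Nat using (ℕ; suc; _≤_)
open import Data.Nat.Properties using (≤-poset; ≤-reflexive; ≤-trans; ≤-antisym; n≤1+n; 1+n≢n)
open import Data.Fin using (Fin; _≟_)
open import Data.Bool using (Bool; true; false)
open import Data.Product using (∃; _×_; _,_; proj₁; proj₂)
open import Data.Sum using (_⊎_; inj₁; inj₂)
open import Data.Vec.Functional using (updateAt)
open import Data.Vec.Functional.Properties using (updateAt-updates; updateAt-minimal)
open import Function.Bundles using (mk⇔; Equivalence)
open import Level using (Level)
open import Relation.Binary.Bundles using (Poset)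
open import Relation.Binary.Core using (Rel)
open import Relation.Binary.Construct.Closure.ReflexiveTransitive using (Star; ε; _◅_)
open import Relation.Binary.Construct.Closure.Transitive using (TransClosure; [_]; _∷_)
import Relation.Binary.Construct.Flip.EqAndOrd as Flip
open import Relation.Binary.PropositionalEquality
open import Relation.Nullary using (¬_; yes; no; contradiction)

private
  variable
    n : ℕ

Orientation : ℕ → Set
Orientation n = Fin n → Fin n → Bool

≡-from-⇒true : {x y : Bool} → (x ≡ true → y ≡ true) → (y ≡ true → x ≡ true) → x ≡ y
≡-from-⇒true {false} {false} _ _ = refl
≡-from-⇒true {false} {true}  _ y⇒x = y⇒x refl
≡-from-⇒true {true}          x⇒y _ = sym (x⇒y refl)

arc◅path⇒plus : ∀ {O : Orientation n} {i j k} →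
                Arc O i j → j ≤[ O ] k → TransClosure (Arc O) i k
arc◅path⇒plus a ε       = [ a ]
arc◅path⇒plus a (b ◅ p) = a ∷ arc◅path⇒plus b p

edge-path⇒arc : ∀ {Y : Graph n} {O v w} → IsAcyc Y O →
                Edge Y v w → v ≤[ O ] w → Arc O v w
edge-path⇒arc {v = v} {w} (orient , acyclic) e p with IsOrientation.someWay orient v w e
... | inj₁ v→w = v→w
... | inj₂ w→v = contradiction (arc◅path⇒plus w→v p) (acyclic w)

-- Applied below with R, S the arcs of the two orientations, h the click count, and the
-- poset ℕ ordered by ≤ or by its converse.
module LevelPaths {a ℓ₁ ℓ₂ v r s : Level} (P : Poset a ℓ₁ ℓ₂) {V : Set v}
  {R : Rel V r} {S : Rel V s} (h : V → Poset.Carrier P)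
  (descends : ∀ {i j} → R i j → Poset._≤_ P (h j) (h i))
  (level⇒S : ∀ {i j} → R i j → Poset._≈_ P (h i) (h j) → S i j) where

  private module P = Poset P
  open P using (_≈_)

  star-descends : ∀ {i j} → Star R i j → h j P.≤ h i
  star-descends ε       = P.refl
  star-descends (r ◅ p) = P.trans (star-descends p) (descends r)

  level-star : ∀ {i j} → h i ≈ h j → Star R i j → Star S i j
  level-star e ε = ε
  level-star {i} e (_◅_ {j = k} r p) =
    level⇒S r i≈k ◅ level-star (P.Eq.trans (P.Eq.sym i≈k) e) p
    where
    i≈k : h i ≈ h k
    i≈k = P.antisym (P.trans (P.reflexive e) (star-descends p)) (descends r)

  between-level : ∀ {x y z} → h x ≈ h z → Star R x y × Star R y z → h y ≈ h x
  between-level x≈z (p , q) =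
    P.antisym (star-descends p) (P.trans (P.reflexive x≈z) (star-descends q))

  between⇒S : ∀ {x y z} → h x ≈ h z → Star R x y × Star R y z → Star S x y × Star S y z
  between⇒S x≈z (p , q) =
    level-star (P.Eq.sym y≈x) p , level-star (P.Eq.trans y≈x x≈z) q
    where
    y≈x = between-level x≈z (p , q)

flipAt-incident : ∀ (s j : Fin n) O → flipAt s O j s ≡ O s j
flipAt-incident s j O with j ≟ s
... | yes _ = refl
... | no _ with s ≟ s
...   | yes _   = refl
...   | no s≢s = contradiction refl s≢s

flipAt-away : ∀ (s i j : Fin n) O → i ≢ s → j ≢ s → flipAt s O i j ≡ O i j
flipAt-away s i j O i≢s j≢s with i ≟ s
... | yes i≡s = contradiction i≡s i≢s
... | no _ with j ≟ s
...   | yes j≡s = contradiction j≡s j≢s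
...   | no _    = refl

KeptOrReversed : Set → Set → ℕ → ℕ → Set
KeptOrReversed kept reversed k l = (kept × k ≡ l) ⊎ (reversed × k ≡ suc l)

keptOrReversed⇒≥ : ∀ {X X′ k l} → KeptOrReversed X X′ k l → l ≤ k
keptOrReversed⇒≥ (inj₁ (_ , k≡l))   = ≤-reflexive (sym k≡l)
keptOrReversed⇒≥ (inj₂ (_ , k≡1+l)) = ≤-trans (n≤1+n _) (≤-reflexive (sym k≡1+l))

keptOrReversed-level : ∀ {X X′ k l} → KeptOrReversed X X′ k l → k ≡ l → X
keptOrReversed-level (inj₁ (x , _))     _   = x
keptOrReversed-level (inj₂ (_ , k≡1+l)) k≡l = contradiction (trans (sym k≡1+l) k≡l) (1+n≢n)

ClickCount : Orientation n → Orientation n → (Fin n → ℕ) → Set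
ClickCount A B h = ∀ {i j} → Arc A i j → KeptOrReversed (Arc B i j) (Arc B j i) (h i) (h j)

click◅clickCount : ∀ {A A′ B : Orientation n} {h} (c : Click A A′) → ClickCount A′ B h →
                   ClickCount A B (updateAt h (proj₁ c) suc)
click◅clickCount {A = A} {h = h} (s , source , A′≡flip) count {i} {j} a
  with i ≟ s | j ≟ s
... | _        | yes refl = contradiction (trans (sym a) (source i)) λ ()
... | yes refl | no j≢i with count (trans (A′≡flip j i) (trans (flipAt-incident i j A) a))
...   | inj₁ (b , hj≡hi)  = inj₂ (b , trans (updateAt-updates i h)
                                    (cong suc (trans (sym hj≡hi) (sym (updateAt-minimal j i h j≢i)))))
...   | inj₂ (b , hj≡1+hi) = inj₁ (b , trans (updateAt-updates i h)
                                    (trans (sym hj≡1+hi) (sym (updateAt-minimal j i h j≢i))))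
click◅clickCount {A = A} {h = h} (s , _ , A′≡flip) count {i} {j} a | no i≢s | no j≢s
  with count (trans (A′≡flip i j) (trans (flipAt-away s i j A i≢s j≢s) a))
... | inj₁ (b , e) = inj₁ (b , trans (updateAt-minimal i s h i≢s)
                                  (trans e (sym (updateAt-minimal j s h j≢s))))
... | inj₂ (b , e) = inj₂ (b , trans (updateAt-minimal i s h i≢s)
                                  (trans e (cong suc (sym (updateAt-minimal j s h j≢s)))))

clicks⇒clickCount : ∀ {A B : Orientation n} → Star Click A B → ∃ (ClickCount A B)
clicks⇒clickCount ε = (λ _ → 0) , λ a → inj₁ (a , refl)
clicks⇒clickCount (c ◅ cs) with clicks⇒clickCount cs
... | _ , count = _ , click◅clickCount c count

module ClickCountProperties {Y : Graph n} {A B : Orientation n} {h : Fin n → ℕ}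
  (A-orient : IsOrientation Y A) (B-orient : IsOrientation Y B) (count : ClickCount A B h) where

  B-one-way : ∀ {i j} → Arc B i j → ¬ Arc B j i
  B-one-way {i} {j} b b′ = contradiction (trans (sym b′) (IsOrientation.oneWay B-orient i j b)) λ ()

  converse : ∀ {i j} → Arc B i j → KeptOrReversed (Arc A i j) (Arc A j i) (h j) (h i)
  converse {i} {j} b
    with IsOrientation.someWay A-orient i j (IsOrientation.onEdges B-orient i j b)
  ... | inj₁ a with count a
  ...   | inj₁ (_ , hi≡hj) = inj₁ (a , sym hi≡hj)
  ...   | inj₂ (b′ , _)    = contradiction b′ (B-one-way b)
  converse {i} {j} b | inj₂ a with count a
  ...   | inj₁ (b′ , _)      = contradiction b′ (B-one-way b)
  ...   | inj₂ (_ , hj≡1+hi) = inj₂ (a , hj≡1+hi)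

  A-descends : ∀ {i j} → Arc A i j → h j ≤ h i
  A-descends a = keptOrReversed⇒≥ (count a)

  B-ascends : ∀ {i j} → Arc B i j → h i ≤ h j
  B-ascends b = keptOrReversed⇒≥ (converse b)

  A-level⇒B : ∀ {i j} → Arc A i j → h i ≡ h j → Arc B i j
  A-level⇒B a = keptOrReversed-level (count a)

  B-level⇒A : ∀ {i j} → Arc B i j → h i ≡ h j → Arc A i j
  B-level⇒A b hi≡hj = keptOrReversed-level (converse b) (sym hi≡hj)

  level-agree : ∀ {i j} → h i ≡ h j → A i j ≡ B i j
  level-agree hi≡hj = ≡-from-⇒true (λ a → A-level⇒B a hi≡hj) (λ b → B-level⇒A b hi≡hj)

sameInterval-after-clicks : ∀ {Y : Graph n} {A B v w} → IsAcyc Y A → IsAcyc Y B →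
  Star Click A B → Edge Y v w → v ≤[ A ] w → v ≤[ B ] w → SameInterval A B v w
sameInterval-after-clicks {A = A} {B} {v} {w} A-acyc B-acyc clicks e v≤Aw v≤Bw =
  (λ _ → mk⇔ (A.between⇒S hv≡hw) (B.between⇒S hv≡hw)) ,
  (λ _ _ a∈ b∈ → level-agree (same-level a∈ b∈)) ,
  (λ _ _ a∈ b∈ → mk⇔ (A.level-star (same-level a∈ b∈)) (B.level-star (same-level a∈ b∈)))
  where
  counted = clicks⇒clickCount clicks
  h = proj₁ counted
  open ClickCountProperties (proj₁ A-acyc) (proj₁ B-acyc) (proj₂ counted)
  module A = LevelPaths ≤-poset h A-descends A-level⇒B
  module B = LevelPaths (Flip.poset ≤-poset) h B-ascends B-level⇒A

  hv≡hw : h v ≡ h w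
  hv≡hw = ≤-antisym (B-ascends (edge-path⇒arc B-acyc e v≤Bw))
                    (A-descends (edge-path⇒arc A-acyc e v≤Aw))

  same-level : ∀ {a b} → InInterval A v w a → InInterval A v w b → h a ≡ h b
  same-level a∈ b∈ = trans (A.between-level hv≡hw a∈) (sym (A.between-level hv≡hw b∈))

SameInterval-sym : ∀ {O¹ O² : Orientation n} {v w} →
                   SameInterval O¹ O² v w → SameInterval O² O¹ v w
SameInterval-sym (vertices , arcs , order) =
  (λ c → mk⇔ (from (vertices c)) (to (vertices c))) ,
  (λ a b a∈ b∈ → sym (arcs a b (from (vertices a) a∈) (from (vertices b) b∈))) ,
  (λ a b a∈ b∈ → let a≤b = order a b (from (vertices a) a∈) (from (vertices b) b∈)
                 in mk⇔ (from a≤b) (to a≤b))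
  where open Equivalence

-- Connectedness of Y and the path avoiding {v, w} in the cycle-edge hypothesis are unused:
-- they only guarantee that some O in each κ-class has v ≤_O w.
proposition5 : (n : ℕ) (Y : Graph n) → Connected Y →
    (v w : Fin n) → CycleEdge Y v w →
    (O¹ O² : Fin n → Fin n → Bool) → IsAcyc Y O¹ → IsAcyc Y O² →
    O¹ ∼κ O² → v ≤[ O¹ ] w → v ≤[ O² ] w →
    SameInterval O¹ O² v w
proposition5 n Y _ v w (e , _) O¹ O² acyc¹ acyc² (inj₁ clicks) v≤w¹ v≤w² =
  sameInterval-after-clicks acyc¹ acyc² clicks e v≤w¹ v≤w²
proposition5 n Y _ v w (e , _) O¹ O² acyc¹ acyc² (inj₂ clicks) v≤w¹ v≤w² =
  SameInterval-sym (sameInterval-after-clicks acyc² acyc¹ clicks e v≤w² v≤w¹)
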